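{- Let $G$ be a Helly graph and $k$ a non-negative integer. (i) $hb(G)\le k$ if and only if there are no four vertices that induce a $C_4$ in $G^\ell$ for every integer $\ell\in[k+1,2k]$ and induce a diamond in $G^{2k+1}$. (ii) $hb(G)\le k+\frac12$ if and only if there are no four vertices that induce a $C_4$ in $G^\ell$ for every integer $\ell\in[k+1,2k+1]$, and there are no four vertices that induce a $C_4$ in $G^\ell$ for every integer $\ell\in[k+2,2k+2]$.
   Context: Graphs are finite, connected, unweighted, undirected and simple; $d$ is the shortest-path distance. A graph is Helly if every family of pairwise intersecting disks $D(v,r)=\{u:d(u,v)\le r\}$ has a common vertex. $hb(G)$ is the maximum over quadruples $u,v,w,x$ of one half of the difference between the two largest of $d(u,v)+d(w,x)$, $d(u,w)+d(v,x)$, $d(u,x)+d(v,w)$. $G^\ell$ is the graph on $V(G)$ with $uv$ an edge iff $0<d(u,v)\le \ell$; $C_4$ is the cycle on four vertices; a diamond is a cycle on four vertices with exactly one chord. -}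

module Defs where

open import Data.Nat using (ℕ; zero; suc; _+_; _*_; _∸_; _≤_; _<_; _⊔_; _⊓_)
open import Data.Fin using (Fin; zero; suc)
open import Data.Bool using (Bool; true; false)
open import Data.Product using (Σ; ∃; _×_; _,_)
open import Relation.Binary.PropositionalEquality using (_≡_)
open import Relation.Nullary using (¬_)
open import Function.Bundles using (_⇔_)
open import Function.Definitions using (Injective)
open import Data.Fin.Permutation using (Permutation′; _⟨$⟩ʳ_)

record Graph : Set₁ where
  field
    n        : ℕ
    adj      : Fin n → Fin n → Bool
    adj-sym  : ∀ u v → adj u v ≡ adj v u
    adj-irr  : ∀ u → adj u u ≡ false

  V : Set
  V = Fin n

  Adj : V → V → Set
  Adj u v = adj u v ≡ true

  data Walk : V → V → ℕ → Set where
    nil  : ∀ {u} → Walk u u 0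
    cons : ∀ {u w v m} → Adj u w → Walk w v m → Walk u v (suc m)

  Dist : V → V → ℕ → Set
  Dist u v m = Walk u v m × (∀ m′ → Walk u v m′ → m ≤ m′)

open Graph public

Connected : Graph → Set
Connected G = ∀ (u v : V G) → ∃ λ m → Walk G u v m

InDisk : (G : Graph) → V G → ℕ → V G → Set
InDisk G c r u = ∃ λ m → Dist G c u m × m ≤ r

Helly : Graph → Set₁
Helly G = ∀ (I : Set) (c : I → V G) (r : I → ℕ) →
  (∀ i j → ∃ λ u → InDisk G (c i) (r i) u × InDisk G (c j) (r j) u) →
  ∃ λ u → ∀ i → InDisk G (c i) (r i) u

max3 : ℕ → ℕ → ℕ → ℕ
max3 a b c = a ⊔ b ⊔ c

mid3 : ℕ → ℕ → ℕ → ℕ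
mid3 a b c = (a ⊓ b) ⊔ (b ⊓ c) ⊔ (a ⊓ c)

-- hb(G) ≤ t/2 : for every quadruple, (largest − second largest) of the three
-- distance sums is ≤ t  (hb = max over quadruples of half that difference).
HbLeHalf : (G : Graph) → ℕ → Set
HbLeHalf G t = ∀ (u v w x : V G) (duv dwx duw dvx dux dvw : ℕ) →
  Dist G u v duv → Dist G w x dwx → Dist G u w duw →
  Dist G v x dvx → Dist G u x dux → Dist G v w dvw →
  let s₁ = duv + dwx ; s₂ = duw + dvx ; s₃ = dux + dvw
  in max3 s₁ s₂ s₃ ∸ mid3 s₁ s₂ s₃ ≤ t

PowAdj : (G : Graph) → ℕ → V G → V G → Set
PowAdj G ℓ u v = ∃ λ m → Dist G u v m × 0 < m × m ≤ ℓ

C4 : Fin 4 → Fin 4 → Bool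
C4 zero (suc zero) = true
C4 (suc zero) zero = true
C4 (suc zero) (suc (suc zero)) = true
C4 (suc (suc zero)) (suc zero) = true
C4 (suc (suc zero)) (suc (suc (suc zero))) = true
C4 (suc (suc (suc zero))) (suc (suc zero)) = true
C4 (suc (suc (suc zero))) zero = true
C4 zero (suc (suc (suc zero))) = true
C4 _ _ = false

Diamond : Fin 4 → Fin 4 → Bool
Diamond zero (suc (suc zero)) = true
Diamond (suc (suc zero)) zero = true
Diamond i j = C4 i j

Induces : {A : Set} → (A → A → Set) → (Fin 4 → Fin 4 → Bool) → (Fin 4 → A) → Set
Induces E P q = Injective _≡_ _≡_ q ×
  Σ (Permutation′ 4) λ σ → ∀ i j → (E (q (σ ⟨$⟩ʳ i)) (q (σ ⟨$⟩ʳ j)) ⇔ (P i j ≡ true))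

-- A quadruple a, b, c, e whose "diagonal" distance sum d(a,c) + d(b,e) beats both
-- other pair sums by more than t witnesses hb(G) > t/2.  The forbidden
-- configurations are squares with short sides and long diagonals, so they are
-- such witnesses.  Conversely, given a witness, Helly's property is used to
-- move a until d(a,b) + d(a,e) ≤ d(b,e) + 1, then to choose B and E at
-- distance K = ⌈(t + 1 + σ)/2⌉ from a on geodesics towards b and e (σ being
-- the remaining defect), and finally a point C at a prescribed distance from a
-- and within K of both B and E; the square a B C E, or B C E a when d(B,E)
-- falls short of 2K, is then a forbidden configuration.
module Submission where

open import Defs
open import Data.Nat using (ℕ; zero; suc; _+_; _*_; _∸_; _≤_; _<_; _≤?_; z≤n; s≤s; _⊔_; _⊓_)
open import Data.Nat.Properties
open import Data.Nat.Induction using (<-rec)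
open import Data.Nat.Tactic.RingSolver using (solve; solve-∀)
open import Data.List using (_∷_; [])
open import Data.Fin using (Fin; zero; suc; #_)
open import Data.Fin.Properties using (all?; any?) renaming (_≟_ to _≟ᶠ_)
import Data.Fin.Permutation as Perm
open import Data.Fin.Permutation using (_⟨$⟩ʳ_; _⟨$⟩ˡ_; inverseʳ; inverseˡ)
open import Data.Bool using (Bool; true; false)
open import Data.Bool.Properties using () renaming (_≟_ to _≟ᵇ_)
open import Data.Empty using (⊥; ⊥-elim)
open import Data.Product using (∃; _×_; _,_; proj₁; proj₂)
open import Data.Sum using (_⊎_; inj₁; inj₂)
open import Relation.Binary.PropositionalEquality
open import Relation.Nullary using (¬_; Dec; yes; no; contradiction)
open import Relation.Nullary.Decidable using (from-yes; map′; _→-dec_; _⊎-dec_; _×-dec_; ¬?)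
open import Function.Base using (_∘_)
open import Function.Bundles using (_⇔_; mk⇔; Equivalence)

-- Linear arithmetic by certificate: A ≤ B follows from a sum of known
-- inequalities S ≤ T as soon as B + S and A + T are equal polynomials.
≤-by-certificate : ∀ {A B S T} → S ≤ T → B + S ≡ A + T → A ≤ B
≤-by-certificate {A} {B} {S} {T} S≤T eq = +-cancelʳ-≤ T A B (≤-trans (≤-reflexive (sym eq)) (+-monoʳ-≤ B S≤T))

infixl 6 _⊕_
_⊕_ : ∀ {a b c e} → a ≤ b → c ≤ e → a + c ≤ b + e
_⊕_ = +-mono-≤

half-≤ : ∀ {m n} → m + m ≤ suc (n + n) → m ≤ n
half-≤ {m} {n} h with m ≤? n
... | yes m≤n = m≤n
... | no m≰n = contradiction h (<⇒≱ 2n+1<2m)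
  where
    n<m = ≰⇒> m≰n
    2n+1<2m : suc (n + n) < m + m
    2n+1<2m = ≤-by-certificate (n<m ⊕ n<m) (solve (m ∷ n ∷ []))

halve : ∀ w → ∃ λ h → h + h ≤ w × w ≤ suc (h + h)
halve zero = 0 , z≤n , z≤n
halve (suc zero) = 0 , z≤n , s≤s z≤n
halve (suc (suc w)) with halve w
... | h , lo , hi = suc h , ≤-by-certificate lo (solve (w ∷ h ∷ [])) , ≤-by-certificate hi (solve (w ∷ h ∷ []))

+-tightˡ : ∀ {a b m n} → a ≤ m → b ≤ n → m + n ≤ a + b → a ≡ m
+-tightˡ {a} {b} {m} {n} a≤m b≤n le = ≤-antisym a≤m (≤-by-certificate (le ⊕ b≤n) (solve (a ∷ b ∷ m ∷ n ∷ [])))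

min≤mid3ᵃᵇ : ∀ a b c → a ⊓ b ≤ mid3 a b c
min≤mid3ᵃᵇ a b c = ≤-trans (m≤m⊔n (a ⊓ b) (b ⊓ c)) (m≤m⊔n _ (a ⊓ c))

min≤mid3ᵇᶜ : ∀ a b c → b ⊓ c ≤ mid3 a b c
min≤mid3ᵇᶜ a b c = ≤-trans (m≤n⊔m (a ⊓ b) (b ⊓ c)) (m≤m⊔n _ (a ⊓ c))

min≤mid3ᵃᶜ : ∀ a b c → a ⊓ c ≤ mid3 a b c
min≤mid3ᵃᶜ a b c = m≤n⊔m ((a ⊓ b) ⊔ (b ⊓ c)) (a ⊓ c)

≤-+⊓ : ∀ {x y t} → x ≤ y + t → x ≤ x ⊓ y + t
≤-+⊓ {x} {y} {t} h with ≤-total x y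
... | inj₁ x≤y = subst (λ z → x ≤ z + t) (sym (m≤n⇒m⊓n≡m x≤y)) (m≤m+n x t)
... | inj₂ y≤x = subst (λ z → x ≤ z + t) (sym (m≥n⇒m⊓n≡n y≤x)) h

spread-≤ : ∀ {a b c t} → a ≤ (b ⊔ c) + t → b ≤ (a ⊔ c) + t → c ≤ (a ⊔ b) + t →
           max3 a b c ∸ mid3 a b c ≤ t
spread-≤ {a} {b} {c} {t} ha hb hc =
  m≤n+o⇒m∸n≤o (max3 a b c) (mid3 a b c) (⊔-lub (⊔-lub (bound ha ma) (bound hb mb)) (bound hc mc))
  where
    bound : ∀ {x y} → x ≤ y + t → x ⊓ y ≤ mid3 a b c → x ≤ mid3 a b c + t
    bound h m = ≤-trans (≤-+⊓ h) (+-monoˡ-≤ t m)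
    ma : a ⊓ (b ⊔ c) ≤ mid3 a b c
    ma rewrite ⊓-distribˡ-⊔ a b c = ⊔-lub (min≤mid3ᵃᵇ a b c) (min≤mid3ᵃᶜ a b c)
    mb : b ⊓ (a ⊔ c) ≤ mid3 a b c
    mb rewrite ⊓-distribˡ-⊔ b a c | ⊓-comm b a = ⊔-lub (min≤mid3ᵃᵇ a b c) (min≤mid3ᵇᶜ a b c)
    mc : c ⊓ (a ⊔ b) ≤ mid3 a b c
    mc rewrite ⊓-distribˡ-⊔ c a b | ⊓-comm c a | ⊓-comm c b = ⊔-lub (min≤mid3ᵃᶜ a b c) (min≤mid3ᵇᶜ a b c)

spread-> : ∀ {a b c t} → suc t + b ≤ a → suc t + c ≤ a → t < max3 a b c ∸ mid3 a b c
spread-> {a} {b} {c} {t} hb hc = ≤-trans gap (∸-mono max≥a mid≤)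
  where
    gap : suc t ≤ a ∸ (b ⊔ c)
    gap = m+n≤o⇒m≤o∸n (suc t) (subst (_≤ a) (sym (+-distribˡ-⊔ (suc t) b c)) (⊔-lub hb hc))
    max≥a : a ≤ max3 a b c
    max≥a = ≤-trans (m≤m⊔n a b) (m≤m⊔n (a ⊔ b) c)
    mid≤ : mid3 a b c ≤ b ⊔ c
    mid≤ = ⊔-lub (⊔-lub (≤-trans (m⊓n≤n a b) (m≤m⊔n b c)) (≤-trans (m⊓n≤m b c) (m≤m⊔n b c)))
                 (≤-trans (m⊓n≤n a c) (m≤n⊔m b c))

module _ {P : ℕ → Set} (P? : ∀ n → Dec (P n)) where

  Least : Set
  Least = ∃ λ n → P n × ∀ k → P k → n ≤ k

  least : ∀ m → P m → Least
  least = <-rec (λ m → P m → Least) step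
    where
      step : ∀ m → (∀ {j} → j < m → P j → Least) → P m → Least
      step m rec Pm with anyUpTo? P? m
      ... | yes (j , j<m , Pj) = rec j<m Pj
      ... | no none = m , Pm , λ k Pk → ≮⇒≥ (λ k<m → none (k , k<m , Pk))

≤-⊔-+-or-dominates : ∀ x y z t → x ≤ (y ⊔ z) + t ⊎ (suc t + y ≤ x × suc t + z ≤ x)
≤-⊔-+-or-dominates x y z t with x ≤? (y ⊔ z) + t
... | yes x≤ = inj₁ x≤
... | no x≰ = inj₂ (bound (m≤m⊔n y z) , bound (m≤n⊔m y z))
  where
    bound : ∀ {a} → a ≤ y ⊔ z → suc t + a ≤ x
    bound a≤ = ≤-trans (s≤s (≤-trans (+-monoʳ-≤ t a≤) (≤-reflexive (+-comm t (y ⊔ z))))) (≰⇒> x≰)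

≤1-cases : ∀ {σ} (P : ℕ → Set) → σ ≤ 1 → P σ → P 0 ⊎ P 1
≤1-cases P z≤n p = inj₁ p
≤1-cases P (s≤s z≤n) p = inj₂ p

-- Cyclic order on Fin 4 and the patterns C4 and Diamond

next : Fin 4 → Fin 4
next zero = suc zero
next (suc zero) = suc (suc zero)
next (suc (suc zero)) = suc (suc (suc zero))
next (suc (suc (suc zero))) = zero

opp : Fin 4 → Fin 4
opp i = next (next i)

opp-≢ : ∀ i → i ≢ opp i
opp-≢ = from-yes (all? λ i → ¬? (i ≟ᶠ opp i))

C4-next : ∀ i → C4 i (next i) ≡ true
C4-next = from-yes (all? λ i → C4 i (next i) ≟ᵇ true)

C4-edge : ∀ i j → C4 i j ≡ true → j ≡ next i ⊎ i ≡ next j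
C4-edge = from-yes (all? λ i → all? λ j → (C4 i j ≟ᵇ true) →-dec ((j ≟ᶠ next i) ⊎-dec (i ≟ᶠ next j)))

C4-non-edge : ∀ i j → i ≢ j → C4 i j ≡ false → j ≡ opp i
C4-non-edge = from-yes (all? λ i → all? λ j → ¬? (i ≟ᶠ j) →-dec ((C4 i j ≟ᵇ false) →-dec (j ≟ᶠ opp i)))

C4-triangle-free : ∀ i j k → C4 i j ≡ true → C4 j k ≡ true → C4 i k ≡ false
C4-triangle-free = from-yes (all? λ i → all? λ j → all? λ k →
  (C4 i j ≟ᵇ true) →-dec (C4 j k ≟ᵇ true) →-dec (C4 i k ≟ᵇ false))

Diamond-next : ∀ i → Diamond i (next i) ≡ true
Diamond-next = from-yes (all? λ i → Diamond i (next i) ≟ᵇ true)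

Diamond-edge : ∀ i j → Diamond i j ≡ true →
  j ≡ next i ⊎ i ≡ next j ⊎ (i ≡ # 0 × j ≡ # 2) ⊎ (i ≡ # 2 × j ≡ # 0)
Diamond-edge = from-yes (all? λ i → all? λ j → (Diamond i j ≟ᵇ true) →-dec
  ((j ≟ᶠ next i) ⊎-dec (i ≟ᶠ next j) ⊎-dec ((i ≟ᶠ # 0) ×-dec (j ≟ᶠ # 2)) ⊎-dec ((i ≟ᶠ # 2) ×-dec (j ≟ᶠ # 0))))

Diamond-non-edge : ∀ i j → i ≢ j → Diamond i j ≡ false → (i ≡ # 1 × j ≡ # 3) ⊎ (i ≡ # 3 × j ≡ # 1)
Diamond-non-edge = from-yes (all? λ i → all? λ j → ¬? (i ≟ᶠ j) →-dec (Diamond i j ≟ᵇ false) →-dec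
  (((i ≟ᶠ # 1) ×-dec (j ≟ᶠ # 3)) ⊎-dec ((i ≟ᶠ # 3) ×-dec (j ≟ᶠ # 1))))

Diamond-no-K4 : ∀ i j k l → Diamond i j ≡ true → Diamond j k ≡ true → Diamond k l ≡ true →
  Diamond l i ≡ true → Diamond i k ≡ true → Diamond j l ≡ false
Diamond-no-K4 = from-yes (all? λ i → all? λ j → all? λ k → all? λ l →
  (Diamond i j ≟ᵇ true) →-dec (Diamond j k ≟ᵇ true) →-dec (Diamond k l ≟ᵇ true) →-dec
  (Diamond l i ≟ᵇ true) →-dec (Diamond i k ≟ᵇ true) →-dec (Diamond j l ≟ᵇ false))

module _ {A : Set} (E : A → A → Set) {P : Fin 4 → Fin 4 → Bool} (q : Fin 4 → A) (I : Induces E P q) where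

  private
    σ = proj₁ (proj₂ I)

  relabelling : Fin 4 → Fin 4
  relabelling i = σ ⟨$⟩ʳ i

  relabelling-injective : ∀ {i j} → q (relabelling i) ≡ q (relabelling j) → i ≡ j
  relabelling-injective eq = trans (sym (inverseˡ σ)) (trans (cong (σ ⟨$⟩ˡ_) (proj₁ I eq)) (inverseˡ σ))

  relabelling-edge : ∀ i j → P i j ≡ true → E (q (relabelling i)) (q (relabelling j))
  relabelling-edge i j = Equivalence.from (proj₂ (proj₂ I) i j)

  label : Fin 4 → Fin 4
  label m = σ ⟨$⟩ˡ m

  induced-edge : ∀ m n → E (q m) (q n) → P (label m) (label n) ≡ true
  induced-edge m n e = Equivalence.to (proj₂ (proj₂ I) (label m) (label n))
    (subst₂ E (sym (cong q (inverseʳ σ))) (sym (cong q (inverseʳ σ))) e)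

module _ {A : Set} (E : A → A → Set) (q : Fin 4 → A) where

  C4-induced-triangle-free : Induces E C4 q → ∀ {m n o} → E (q m) (q n) → E (q n) (q o) → ¬ E (q m) (q o)
  C4-induced-triangle-free I {m} {n} {o} e₁ e₂ e₃ =
    contradiction (trans (sym (edge m o e₃)) (C4-triangle-free (π m) (π n) (π o) (edge m n e₁) (edge n o e₂))) λ ()
    where
      π = label E q I
      edge : ∀ m n → E (q m) (q n) → C4 (π m) (π n) ≡ true
      edge = induced-edge E q I

  Diamond-induced-no-K4 : Induces E Diamond q → ∀ {m₀ m₁ m₂ m₃} →
    E (q m₀) (q m₁) → E (q m₁) (q m₂) → E (q m₂) (q m₃) → E (q m₃) (q m₀) → E (q m₀) (q m₂) → ¬ E (q m₁) (q m₃)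
  Diamond-induced-no-K4 I {m₀} {m₁} {m₂} {m₃} e₀₁ e₁₂ e₂₃ e₃₀ e₀₂ e₁₃ =
    contradiction (trans (sym (edge m₁ m₃ e₁₃))
      (Diamond-no-K4 (π m₀) (π m₁) (π m₂) (π m₃) (edge m₀ m₁ e₀₁) (edge m₁ m₂ e₁₂) (edge m₂ m₃ e₂₃)
                                                  (edge m₃ m₀ e₃₀) (edge m₀ m₂ e₀₂))) λ ()
    where
      π = label E q I
      edge : ∀ m n → E (q m) (q n) → Diamond (π m) (π n) ≡ true
      edge = induced-edge E q I

module Distance (G : Graph) (connected : Connected G) where

  private
    variable
      u v w : V G
      m m′ : ℕ

  _▷_ : Walk G u v m → Adj G v w → Walk G u w (suc m)
  nil ▷ e = cons e nil
  cons e′ p ▷ e = cons e′ (p ▷ e)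

  reverse : Walk G u v m → Walk G v u m
  reverse nil = nil
  reverse {u} {v} (cons {w = w} e p) = reverse p ▷ trans (adj-sym G w u) e

  _++_ : Walk G u v m → Walk G v w m′ → Walk G u w (m + m′)
  nil ++ q = q
  cons e p ++ q = cons e (p ++ q)

  splitAt : ∀ m → Walk G u v (m + m′) → ∃ λ w → Walk G u w m × Walk G w v m′
  splitAt zero p = _ , nil , p
  splitAt (suc m) (cons e p) with splitAt m p
  ... | w , p₁ , p₂ = w , cons e p₁ , p₂

  empty-walk : Walk G u v 0 → u ≡ v
  empty-walk nil = refl

  walk? : ∀ m u v → Dec (Walk G u v m)
  walk? zero u v with u ≟ᶠ v
  ... | yes refl = yes nil
  ... | no u≢v = no (λ p → u≢v (empty-walk p))
  walk? (suc m) u v = map′ (λ (w , e , p) → cons e p) (λ { (cons e p) → _ , e , p })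
    (any? (λ w → (adj G u w ≟ᵇ true) ×-dec walk? m w v))

  abstract
    shortest : ∀ u v → ∃ λ m → Dist G u v m
    shortest u v = least (λ m → walk? m u v) _ (proj₂ (connected u v))

    d : V G → V G → ℕ
    d u v = proj₁ (shortest u v)

    Dist-d : ∀ u v → Dist G u v (d u v)
    Dist-d u v = proj₂ (shortest u v)

  d-walk : ∀ u v → Walk G u v (d u v)
  d-walk u v = proj₁ (Dist-d u v)

  d-minimal : Walk G u v m → d u v ≤ m
  d-minimal {u} {v} p = proj₂ (Dist-d u v) _ p

  Dist-unique : Dist G u v m → m ≡ d u v
  Dist-unique {u} {v} (p , minimal) = ≤-antisym (minimal _ (d-walk u v)) (d-minimal p)

  d-refl : ∀ u → d u u ≡ 0
  d-refl u = n≤0⇒n≡0 (d-minimal {u} nil)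

  d≡0⇒≡ : d u v ≡ 0 → u ≡ v
  d≡0⇒≡ {u} {v} eq = empty-walk (subst (Walk G u v) eq (d-walk u v))

  d-sym : ∀ u v → d u v ≡ d v u
  d-sym u v = ≤-antisym (d-minimal (reverse (d-walk v u))) (d-minimal (reverse (d-walk u v)))

  d-sym-≤ : ∀ {u v n} → d u v ≤ n → d v u ≤ n
  d-sym-≤ {u} {v} {n} = subst (_≤ n) (d-sym u v)

  d-sym-< : ∀ {u v n} → n < d u v → n < d v u
  d-sym-< {u} {v} {n} = subst (n <_) (d-sym u v)

  d-triangle : ∀ u v w → d u w ≤ d u v + d v w
  d-triangle u v w = d-minimal (d-walk u v ++ d-walk v w)

  d-split : ∀ u v r s → d u v ≤ r + s → ∃ λ w → d u w ≤ r × d w v ≤ s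
  d-split u v r s d≤r+s with d u v ≤? r
  ... | yes d≤r = v , d≤r , subst (_≤ s) (sym (d-refl v)) z≤n
  ... | no d≰r with splitAt r (subst (Walk G u v) (sym (m+[n∸m]≡n (<⇒≤ (≰⇒> d≰r)))) (d-walk u v))
  ...   | w , p₁ , p₂ = w , d-minimal p₁ , ≤-trans (d-minimal p₂) (m≤n+o⇒m∸n≤o (d u v) r d≤r+s)

  d-triangle′ : ∀ u v w → d u w ≤ d u v + d w v
  d-triangle′ u v w = subst (λ z → d u w ≤ d u v + z) (d-sym v w) (d-triangle u v w)

  d-triangle″ : ∀ u v w → d u w ≤ d v u + d v w
  d-triangle″ u v w = subst (λ z → d u w ≤ z + d v w) (d-sym u v) (d-triangle u v w)

  d-pos : u ≢ v → 0 < d u v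
  d-pos {u} {v} u≢v with d u v in eq
  ... | zero = contradiction (d≡0⇒≡ eq) u≢v
  ... | suc _ = s≤s z≤n

  d-separated : ∀ {x y z r} → d x y ≤ r → r < d x z → 0 < d y z
  d-separated {x} {y} {z} {r} xy≤r r<xz = d-pos λ { refl → <⇒≱ r<xz xy≤r }

  -- The four-point condition

  HbWitness : ℕ → V G → V G → V G → V G → Set
  HbWitness t a b c e = suc t + (d a b + d c e) ≤ d a c + d b e × suc t + (d a e + d c b) ≤ d a c + d b e

  witness-refutes-hb : ∀ {t a b c e} → HbWitness t a b c e → ¬ HbLeHalf G t
  witness-refutes-hb {t} {a} {b} {c} {e} (w₁ , w₂) hb = <⇒≱ (spread-> w₁ w₂)
    (hb a c b e _ _ _ _ _ _ (Dist-d a c) (Dist-d b e) (Dist-d a b) (Dist-d c e) (Dist-d a e) (Dist-d c b))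

  hb-from-no-witness : ∀ {t} → (∀ a b c e → ¬ HbWitness t a b c e) → HbLeHalf G t
  hb-from-no-witness {t} none u v w x _ _ _ _ _ _ Duv Dwx Duw Dvx Dux Dvw
    rewrite Dist-unique Duv | Dist-unique Dwx | Dist-unique Duw
          | Dist-unique Dvx | Dist-unique Dux | Dist-unique Dvw =
    spread-≤ (≤-or-witness s₁ s₂ s₃ λ h₂ h₃ → none u w v x (h₂ , h₃))
             (≤-or-witness s₂ s₁ s₃ λ h₁ h₃ → none u v w x
               (h₁ , subst (λ z → suc t + (d u x + z) ≤ s₂) (d-sym v w) h₃))
             (≤-or-witness s₃ s₁ s₂ λ h₁ h₂ → none u v x w
               (subst (λ z → suc t + (d u v + z) ≤ s₃) (d-sym w x) h₁ ,
                subst (λ z → suc t + (d u w + z) ≤ s₃) (d-sym v x) h₂))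
    where
      s₁ = d u v + d w x
      s₂ = d u w + d v x
      s₃ = d u x + d v w
      ≤-or-witness : ∀ a b c → (suc t + b ≤ a → suc t + c ≤ a → ⊥) → a ≤ (b ⊔ c) + t
      ≤-or-witness a b c no-witness with ≤-⊔-+-or-dominates a b c t
      ... | inj₁ a≤ = a≤
      ... | inj₂ (h₁ , h₂) = ⊥-elim (no-witness h₁ h₂)

  witness-shift : ∀ {t a b c e A h} → HbWitness t a b c e →
    d a A ≤ h → d A b + h ≤ d a b → d A e + h ≤ d a e → HbWitness t A b c e
  witness-shift {t} {a} {b} {c} {e} {A} {h} (D₁ , D₂) aA≤h Ab+h≤ Ae+h≤ =
    shift (d a b) (d c e) (d A b) D₁ Ab+h≤ , shift (d a e) (d c b) (d A e) D₂ Ae+h≤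
    where
      ac≤ : d a c ≤ h + d A c
      ac≤ = ≤-trans (d-triangle a A c) (+-monoˡ-≤ (d A c) aA≤h)
      shift′ : ∀ x y z p r p′ → suc t + (p + r) ≤ x + y → p′ + h ≤ p → x ≤ h + z → suc t + (p′ + r) ≤ z + y
      shift′ x y z p r p′ D p′+h≤p x≤ =
        ≤-by-certificate (D ⊕ p′+h≤p ⊕ x≤) (solve (t ∷ h ∷ x ∷ y ∷ z ∷ p ∷ r ∷ p′ ∷ []))
      shift : ∀ p r p′ → suc t + (p + r) ≤ d a c + d b e → p′ + h ≤ p → suc t + (p′ + r) ≤ d A c + d b e
      shift p r p′ D p′+h≤p = shift′ (d a c) (d b e) (d A c) p r p′ D p′+h≤p ac≤

  -- Squares in the powers of G

  Side : ℕ → V G → V G → Set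
  Side ℓ u v = 0 < d u v × d u v ≤ ℓ

  Side-sym : ∀ {ℓ u v} → Side ℓ u v → Side ℓ v u
  Side-sym (pos , ≤ℓ) = d-sym-< pos , d-sym-≤ ≤ℓ

  PowAdj⇔Side : ∀ {ℓ u v} → PowAdj G ℓ u v ⇔ Side ℓ u v
  PowAdj⇔Side {ℓ} {u} {v} = mk⇔
    (λ (m , dist , pos , ≤ℓ) → subst (0 <_) (Dist-unique dist) pos , subst (_≤ ℓ) (Dist-unique dist) ≤ℓ)
    (λ (pos , ≤ℓ) → d u v , Dist-d u v , pos , ≤ℓ)

  ¬PowAdj⇒far : ∀ {ℓ u v} → u ≢ v → ¬ PowAdj G ℓ u v → ℓ < d u v
  ¬PowAdj⇒far {ℓ} {u} {v} u≢v ¬adj with d u v ≤? ℓ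
  ... | no d≰ℓ = ≰⇒> d≰ℓ
  ... | yes d≤ℓ = contradiction (Equivalence.from PowAdj⇔Side (d-pos u≢v , d≤ℓ)) ¬adj

  PowAdj-mono : ∀ {ℓ ℓ′ u v} → ℓ ≤ ℓ′ → PowAdj G ℓ u v → PowAdj G ℓ′ u v
  PowAdj-mono ℓ≤ℓ′ (m , dist , pos , m≤ℓ) = m , dist , pos , ≤-trans m≤ℓ ℓ≤ℓ′

  Side-mono : ∀ {ℓ ℓ′ u v} → ℓ ≤ ℓ′ → Side ℓ u v → Side ℓ′ u v
  Side-mono ℓ≤ℓ′ (pos , d≤ℓ) = pos , ≤-trans d≤ℓ ℓ≤ℓ′

  Square : ℕ → ℕ → (Fin 4 → V G) → Set
  Square s g q = (∀ i → Side s (q i) (q (next i))) × (∀ i → g < d (q i) (q (opp i)))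

  quad : V G → V G → V G → V G → Fin 4 → V G
  quad A B C E zero = A
  quad A B C E (suc zero) = B
  quad A B C E (suc (suc zero)) = C
  quad A B C E (suc (suc (suc zero))) = E

  square : ∀ {s g A B C E} → Side s A B → Side s B C → Side s C E → Side s E A →
           g < d A C → g < d B E → Square s g (quad A B C E)
  square {g = g} {A} {B} {C} {E} AB BC CE EA AC BE = sides , diagonals
    where
      sides : ∀ i → Side _ (quad A B C E i) (quad A B C E (next i))
      sides zero = AB
      sides (suc zero) = BC
      sides (suc (suc zero)) = CE
      sides (suc (suc (suc zero))) = EA
      diagonals : ∀ i → g < d (quad A B C E i) (quad A B C E (opp i))
      diagonals zero = AC
      diagonals (suc zero) = BE
      diagonals (suc (suc zero)) = d-sym-< AC
      diagonals (suc (suc (suc zero))) = d-sym-< BE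

  induces-by-distance : ∀ {ℓ} P q → (∀ i j → P i j ≡ true → Side ℓ (q i) (q j)) →
    (∀ i j → i ≢ j → P i j ≡ false → ℓ < d (q i) (q j)) → Induces (PowAdj G ℓ) P q
  induces-by-distance {ℓ} P q edge non-edge = injective , Perm.id , λ i j → mk⇔ (to i j) (from i j)
    where
      separated : ∀ i j → i ≢ j → 0 < d (q i) (q j)
      separated i j i≢j with P i j in eq
      ... | true = proj₁ (edge i j eq)
      ... | false = ≤-trans (s≤s z≤n) (non-edge i j i≢j eq)
      injective : ∀ {i j} → q i ≡ q j → i ≡ j
      injective {i} {j} qi≡qj with i ≟ᶠ j
      ... | yes i≡j = i≡j
      ... | no i≢j = contradiction (subst (λ v → 0 < d (q i) v) (sym qi≡qj) (separated i j i≢j))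
                                   (λ pos → <⇒≢ pos (sym (d-refl (q i))))
      to : ∀ i j → PowAdj G ℓ (q i) (q j) → P i j ≡ true
      to i j adj with P i j in eq | Equivalence.to PowAdj⇔Side adj
      ... | true | _ = refl
      ... | false | pos , d≤ℓ with i ≟ᶠ j
      ...   | yes refl = contradiction (d-refl (q i)) (<⇒≢ pos ∘ sym)
      ...   | no i≢j = contradiction d≤ℓ (<⇒≱ (non-edge i j i≢j eq))
      from : ∀ i j → P i j ≡ true → PowAdj G ℓ (q i) (q j)
      from i j e = Equivalence.from PowAdj⇔Side (edge i j e)

  square⇒C4 : ∀ {s g ℓ q} → Square s g q → s ≤ ℓ → ℓ ≤ g → Induces (PowAdj G ℓ) C4 q
  square⇒C4 {q = q} (sides , diagonals) s≤ℓ ℓ≤g = induces-by-distance C4 q edge non-edge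
    where
      edge : ∀ i j → C4 i j ≡ true → Side _ (q i) (q j)
      edge i j e with C4-edge i j e
      ... | inj₁ refl = Side-mono s≤ℓ (sides i)
      ... | inj₂ refl = Side-sym (Side-mono s≤ℓ (sides j))
      non-edge : ∀ i j → i ≢ j → C4 i j ≡ false → _ < d (q i) (q j)
      non-edge i j i≢j e with C4-non-edge i j i≢j e
      ... | refl = ≤-<-trans ℓ≤g (diagonals i)

  square⇒Diamond : ∀ {s g ℓ q} → Square s g q → s ≤ ℓ →
    d (q (# 0)) (q (# 2)) ≤ ℓ → ℓ < d (q (# 1)) (q (# 3)) → Induces (PowAdj G ℓ) Diamond q
  square⇒Diamond {q = q} (sides , diagonals) s≤ℓ chord far = induces-by-distance Diamond q edge non-edge
    where
      short-chord : Side _ (q (# 0)) (q (# 2))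
      short-chord = ≤-trans (s≤s z≤n) (diagonals (# 0)) , chord
      edge : ∀ i j → Diamond i j ≡ true → Side _ (q i) (q j)
      edge i j e with Diamond-edge i j e
      ... | inj₁ refl = Side-mono s≤ℓ (sides i)
      ... | inj₂ (inj₁ refl) = Side-sym (Side-mono s≤ℓ (sides j))
      ... | inj₂ (inj₂ (inj₁ (refl , refl))) = short-chord
      ... | inj₂ (inj₂ (inj₂ (refl , refl))) = Side-sym short-chord
      non-edge : ∀ i j → i ≢ j → Diamond i j ≡ false → _ < d (q i) (q j)
      non-edge i j i≢j e with Diamond-non-edge i j i≢j e
      ... | inj₁ (refl , refl) = far
      ... | inj₂ (refl , refl) = d-sym-< far

  C4s⇒square : ∀ {ℓ₁ ℓ₂ q} → ℓ₁ ≤ ℓ₂ → Induces (PowAdj G ℓ₁) C4 q → Induces (PowAdj G ℓ₂) C4 q →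
               ∃ λ ρ → Square ℓ₁ ℓ₂ (q ∘ ρ)
  C4s⇒square {ℓ₁} {ℓ₂} {q} ℓ₁≤ℓ₂ I₁ I₂ = ρ , sides , diagonals
    where
      ρ = relabelling (PowAdj G ℓ₁) q I₁
      adjacent : ∀ i → PowAdj G ℓ₁ (q (ρ i)) (q (ρ (next i)))
      adjacent i = relabelling-edge (PowAdj G ℓ₁) q I₁ i (next i) (C4-next i)
      sides : ∀ i → Side ℓ₁ (q (ρ i)) (q (ρ (next i)))
      sides i = Equivalence.to PowAdj⇔Side (adjacent i)
      diagonals : ∀ i → ℓ₂ < d (q (ρ i)) (q (ρ (opp i)))
      diagonals i = ¬PowAdj⇒far (opp-≢ i ∘ relabelling-injective (PowAdj G ℓ₁) q I₁)
        (C4-induced-triangle-free (PowAdj G ℓ₂) q I₂ (PowAdj-mono ℓ₁≤ℓ₂ (adjacent i))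
                                                     (PowAdj-mono ℓ₁≤ℓ₂ (adjacent (next i))))

  Diamond⇒square : ∀ {ℓ q} → Induces (PowAdj G ℓ) Diamond q → ∃ λ ρ → Square ℓ 0 (q ∘ ρ)
  Diamond⇒square {ℓ} {q} I = ρ , sides , diagonals
    where
      ρ = relabelling (PowAdj G ℓ) q I
      sides : ∀ i → Side ℓ (q (ρ i)) (q (ρ (next i)))
      sides i = Equivalence.to PowAdj⇔Side (relabelling-edge (PowAdj G ℓ) q I i (next i) (Diamond-next i))
      diagonals : ∀ i → 0 < d (q (ρ i)) (q (ρ (opp i)))
      diagonals i = d-pos (opp-≢ i ∘ relabelling-injective (PowAdj G ℓ) q I)

  Diamond-far-diagonal : ∀ {ℓ s g q} → Induces (PowAdj G ℓ) Diamond q → ∀ ρ → s ≤ ℓ → Square s g (q ∘ ρ) →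
    ℓ < d (q (ρ (# 0))) (q (ρ (# 2))) ⊎ ℓ < d (q (ρ (# 1))) (q (ρ (# 3)))
  Diamond-far-diagonal {ℓ} {q = q} I ρ s≤ℓ (sides , diagonals)
    with d (q (ρ (# 0))) (q (ρ (# 2))) ≤? ℓ | d (q (ρ (# 1))) (q (ρ (# 3))) ≤? ℓ
  ... | no d₀₂≰ℓ | _ = inj₁ (≰⇒> d₀₂≰ℓ)
  ... | yes _ | no d₁₃≰ℓ = inj₂ (≰⇒> d₁₃≰ℓ)
  ... | yes d₀₂≤ℓ | yes d₁₃≤ℓ = contradiction (diagonal (# 1) d₁₃≤ℓ)
    (Diamond-induced-no-K4 (PowAdj G ℓ) q I (side (# 0)) (side (# 1)) (side (# 2)) (side (# 3))
                                             (diagonal (# 0) d₀₂≤ℓ))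
    where
      side : ∀ i → PowAdj G ℓ (q (ρ i)) (q (ρ (next i)))
      side i = Equivalence.from PowAdj⇔Side (Side-mono s≤ℓ (sides i))
      diagonal : ∀ i → d (q (ρ i)) (q (ρ (opp i))) ≤ ℓ → PowAdj G ℓ (q (ρ i)) (q (ρ (opp i)))
      diagonal i d≤ℓ = Equivalence.from PowAdj⇔Side (≤-trans (s≤s z≤n) (diagonals i) , d≤ℓ)

  square-from-sides : ∀ {K g A B C E} → d A B ≤ K → d B C ≤ K → d C E ≤ K → d E A ≤ K → K < d B E →
                      g < d A C → g < d B E → Square K g (quad A B C E)
  square-from-sides AB BC CE EA K<BE =
    square (d-separated EA (d-sym-< K<BE) , AB) (d-sym-< (d-separated (d-sym-≤ CE) (d-sym-< K<BE)) , BC)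
           (d-separated BC K<BE , CE) (d-sym-< (d-separated (d-sym-≤ AB) K<BE) , EA)

  DiamondSquare : ℕ → (Fin 4 → V G) → Set
  DiamondSquare k q =
    Square (suc k) (2 * k) q × d (q (# 0)) (q (# 2)) ≤ suc (2 * k) × suc (2 * k) < d (q (# 1)) (q (# 3))

  square-refutes-hb : ∀ {s g t q} → Square s g q →
    s + s + suc t ≤ d (q (# 0)) (q (# 2)) + d (q (# 1)) (q (# 3)) → ¬ HbLeHalf G t
  square-refutes-hb {s} {g} {t} {q} (sides , _) long = witness-refutes-hb
    (exceeds (side (# 0)) (side (# 2)) , exceeds (side′ (# 3)) (side′ (# 1)))
    where
      side : ∀ i → d (q i) (q (next i)) ≤ s
      side i = proj₂ (sides i)
      side′ : ∀ i → d (q (next i)) (q i) ≤ s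
      side′ i = d-sym-≤ (side i)
      exceeds : ∀ {x y} → x ≤ s → y ≤ s → suc t + (x + y) ≤ d (q (# 0)) (q (# 2)) + d (q (# 1)) (q (# 3))
      exceeds x≤s y≤s = ≤-trans (+-monoʳ-≤ (suc t) (x≤s ⊕ y≤s)) (≤-trans (≤-reflexive (+-comm (suc t) (s + s))) long)

  BandC4 : ℕ → ℕ → (Fin 4 → V G) → Set
  BandC4 s g q = ∀ ℓ → s ≤ ℓ → ℓ ≤ g → Induces (PowAdj G ℓ) C4 q

  band⇒square : ∀ {s g q} → s ≤ g → BandC4 s g q → ∃ λ ρ → Square s g (q ∘ ρ)
  band⇒square s≤g band = C4s⇒square s≤g (band _ ≤-refl s≤g) (band _ s≤g ≤-refl)

  square⇒band : ∀ {s g q} → Square s g q → BandC4 s g q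
  square⇒band sq ℓ s≤ℓ ℓ≤g = square⇒C4 sq s≤ℓ ℓ≤g

  band-refutes-hb : ∀ {s g t q} → s ≤ g → s + s + suc t ≤ suc g + suc g → BandC4 s g q → ¬ HbLeHalf G t
  band-refutes-hb s≤g short band =
    let ρ , sq = band⇒square s≤g band in square-refutes-hb sq (≤-trans short (proj₂ sq (# 0) ⊕ proj₂ sq (# 1)))

  narrow-band-refutes-hb : ∀ k {q} → BandC4 (suc k) (suc (2 * k)) q → ¬ HbLeHalf G (suc (2 * k))
  narrow-band-refutes-hb k = band-refutes-hb (s≤s (m≤m+n k (k + 0))) (≤-reflexive (solve (k ∷ [])))

  wide-band-refutes-hb : ∀ k {q} → BandC4 (suc (suc k)) (suc (suc (2 * k))) q → ¬ HbLeHalf G (suc (2 * k))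
  wide-band-refutes-hb k = band-refutes-hb (s≤s (s≤s (m≤m+n k (k + 0)))) (≤-reflexive (solve (k ∷ [])))

  diamond-band⇒square : ∀ k {q} → BandC4 (suc k) (2 * k) q → Induces (PowAdj G (suc (2 * k))) Diamond q →
                        ∃ λ ρ → Square (suc k) (2 * k) (q ∘ ρ)
  diamond-band⇒square zero _ I = Diamond⇒square I
  diamond-band⇒square (suc k) band _ = band⇒square K≤2k band
    where
      K≤2k : suc (suc k) ≤ 2 * suc k
      K≤2k = ≤-by-certificate (z≤n {k}) (solve (k ∷ []))

  diamond-band-refutes-hb : ∀ k {q} → BandC4 (suc k) (2 * k) q → Induces (PowAdj G (suc (2 * k))) Diamond q →
                            ¬ HbLeHalf G (2 * k)
  diamond-band-refutes-hb k {q} band I =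
    let ρ , sq = diamond-band⇒square k band I in refute sq (Diamond-far-diagonal I ρ (s≤s (m≤m+n k (k + 0))) sq)
    where
      2K+N≡ : ∀ k → suc k + suc k + suc (2 * k) ≡ suc (suc (2 * k)) + suc (2 * k)
      2K+N≡ = solve-∀
      2K+N≡′ : ∀ k → suc k + suc k + suc (2 * k) ≡ suc (2 * k) + suc (suc (2 * k))
      2K+N≡′ = solve-∀
      refute : ∀ {q} → Square (suc k) (2 * k) q →
               suc (2 * k) < d (q (# 0)) (q (# 2)) ⊎ suc (2 * k) < d (q (# 1)) (q (# 3)) → ¬ HbLeHalf G (2 * k)
      refute sq (inj₁ far₀₂) = square-refutes-hb sq (≤-trans (≤-reflexive (2K+N≡ k)) (far₀₂ ⊕ proj₂ sq (# 1)))
      refute sq (inj₂ far₁₃) = square-refutes-hb sq (≤-trans (≤-reflexive (2K+N≡′ k)) (proj₂ sq (# 0) ⊕ far₁₃))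

  -- Helly graphs

  module _ (helly : Helly G) where

    helly-center : ∀ {I : Set} (c : I → V G) (r : I → ℕ) → (∀ i j → d (c i) (c j) ≤ r i + r j) →
                   ∃ λ u → ∀ i → d (c i) u ≤ r i
    helly-center {I} c r pairwise =
      let u , common = helly I c r meet in u , λ i → disk-bound (common i)
      where
        in-disk : ∀ {c r u} → d c u ≤ r → InDisk G c r u
        in-disk {c} {r} {u} h = d c u , Dist-d c u , h
        disk-bound : ∀ {c r u} → InDisk G c r u → d c u ≤ r
        disk-bound {r = r} (m , dist , m≤r) = subst (_≤ r) (Dist-unique dist) m≤r
        meet : ∀ i j → ∃ λ u → InDisk G (c i) (r i) u × InDisk G (c j) (r j) u
        meet i j with d-split (c i) (c j) (r i) (r j) (pairwise i j)
        ... | u , iu , uj = u , in-disk iu , in-disk (d-sym-≤ uj)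

    helly₄ : ∀ c₀ c₁ c₂ c₃ r₀ r₁ r₂ r₃ →
      d c₀ c₁ ≤ r₀ + r₁ → d c₀ c₂ ≤ r₀ + r₂ → d c₀ c₃ ≤ r₀ + r₃ →
      d c₁ c₂ ≤ r₁ + r₂ → d c₁ c₃ ≤ r₁ + r₃ → d c₂ c₃ ≤ r₂ + r₃ →
      ∃ λ u → d c₀ u ≤ r₀ × d c₁ u ≤ r₁ × d c₂ u ≤ r₂ × d c₃ u ≤ r₃
    helly₄ c₀ c₁ c₂ c₃ r₀ r₁ r₂ r₃ h₀₁ h₀₂ h₀₃ h₁₂ h₁₃ h₂₃ =
      let u , near = helly-center c r pairwise in u , near (# 0) , near (# 1) , near (# 2) , near (# 3)
      where
        c = quad c₀ c₁ c₂ c₃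
        r : Fin 4 → ℕ
        r zero = r₀
        r (suc zero) = r₁
        r (suc (suc zero)) = r₂
        r (suc (suc (suc zero))) = r₃
        flip : ∀ i j → d (c i) (c j) ≤ r i + r j → d (c j) (c i) ≤ r j + r i
        flip i j = subst₂ _≤_ (d-sym (c i) (c j)) (+-comm (r i) (r j))
        self : ∀ i → d (c i) (c i) ≤ r i + r i
        self i = subst (_≤ r i + r i) (sym (d-refl (c i))) z≤n
        pairwise : ∀ i j → d (c i) (c j) ≤ r i + r j
        pairwise zero zero = self (# 0)
        pairwise zero (suc zero) = h₀₁
        pairwise zero (suc (suc zero)) = h₀₂
        pairwise zero (suc (suc (suc zero))) = h₀₃
        pairwise (suc zero) (suc zero) = self (# 1)
        pairwise (suc zero) (suc (suc zero)) = h₁₂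
        pairwise (suc zero) (suc (suc (suc zero))) = h₁₃
        pairwise (suc (suc zero)) (suc (suc zero)) = self (# 2)
        pairwise (suc (suc zero)) (suc (suc (suc zero))) = h₂₃
        pairwise (suc (suc (suc zero))) (suc (suc (suc zero))) = self (# 3)
        pairwise (suc zero) zero = flip (# 0) (# 1) h₀₁
        pairwise (suc (suc zero)) zero = flip (# 0) (# 2) h₀₂
        pairwise (suc (suc (suc zero))) zero = flip (# 0) (# 3) h₀₃
        pairwise (suc (suc zero)) (suc zero) = flip (# 1) (# 2) h₁₂
        pairwise (suc (suc (suc zero))) (suc zero) = flip (# 1) (# 3) h₁₃
        pairwise (suc (suc (suc zero))) (suc (suc zero)) = flip (# 2) (# 3) h₂₃

    helly₃ : ∀ c₀ c₁ c₂ r₀ r₁ r₂ → d c₀ c₁ ≤ r₀ + r₁ → d c₀ c₂ ≤ r₀ + r₂ → d c₁ c₂ ≤ r₁ + r₂ →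
      ∃ λ u → d c₀ u ≤ r₀ × d c₁ u ≤ r₁ × d c₂ u ≤ r₂
    helly₃ c₀ c₁ c₂ r₀ r₁ r₂ h₀₁ h₀₂ h₁₂ =
      let u , near₀ , near₁ , near₂ , _ = helly₄ c₀ c₁ c₂ c₂ r₀ r₁ r₂ r₂ h₀₁ h₀₂ h₀₂ h₁₂ h₁₂ self
      in u , near₀ , near₁ , near₂
      where self = subst (_≤ r₂ + r₂) (sym (d-refl c₂)) z≤n

    point-toward : ∀ u v w K N → K ≤ d u v → N ≤ d u w → N ≤ K + K → d v w + N ≤ d u v + d u w →
                   ∃ λ B → d u B ≡ K × d B v + K ≤ d u v × d w B + N ≤ K + d u w
    point-toward u v w K N K≤uv N≤uw N≤2K vw+N≤ =
      let B , uB≤K , vB≤P , wB≤K+M = helly₃ u v w K P (K + M) (≤-reflexive (sym uv≡)) uw≤ vw≤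
          Bv≤P = d-sym-≤ vB≤P
      in B , +-tightˡ uB≤K Bv≤P (subst (_≤ d u B + d B v) (sym uv≡) (d-triangle u B v))
           , ≤-trans (+-monoˡ-≤ K Bv≤P) (≤-reflexive (trans (+-comm P K) uv≡))
           , ≤-trans (+-monoˡ-≤ N wB≤K+M) (≤-reflexive (trans (+-assoc K M N) (cong (K +_) (trans (+-comm M N) uw≡))))
      where
        P = d u v ∸ K
        M = d u w ∸ N
        uv≡ : K + P ≡ d u v
        uv≡ = m+[n∸m]≡n K≤uv
        uw≡ : N + M ≡ d u w
        uw≡ = m+[n∸m]≡n N≤uw
        uw≤ : d u w ≤ K + (K + M)
        uw≤ = subst (_≤ K + (K + M)) uw≡ (≤-trans (+-monoˡ-≤ M N≤2K) (≤-reflexive (+-assoc K K M)))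
        shuffle : ∀ K P N M → (K + P) + (N + M) ≡ (P + (K + M)) + N
        shuffle = solve-∀
        vw≤ : d v w ≤ P + (K + M)
        vw≤ = +-cancelʳ-≤ N _ _ (≤-trans vw+N≤ (≤-reflexive (trans (sym (cong₂ _+_ uv≡ uw≡)) (shuffle K P N M))))

    record Opposite (a B E : V G) (K L : ℕ) : Set where
      field
        C : V G
        BC≤K : d B C ≤ K
        EC≤K : d E C ≤ K
        aC≡L : d a C ≡ L

    opposite-point : ∀ a B E c K L → d a B ≤ K → d a E ≤ K → L ≤ d a c →
      d c B + L ≤ K + d a c → d c E + L ≤ K + d a c → Opposite a B E K L
    opposite-point a B E c K L aB≤K aE≤K L≤ac cB+L≤ cE+L≤ =
      let C , BC≤K , EC≤K , aC≤L , cC≤M = helly₄ B E a c K K L M BE≤ (toward-a aB≤K) (toward-c cB+L≤)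
                                                               (toward-a aE≤K) (toward-c cE+L≤) (≤-reflexive (sym ac≡))
          Cc≤M = d-sym-≤ cC≤M
      in record { C = C ; BC≤K = BC≤K ; EC≤K = EC≤K
                ; aC≡L = +-tightˡ aC≤L Cc≤M (subst (_≤ d a C + d C c) (sym ac≡) (d-triangle a C c)) }
      where
        M = d a c ∸ L
        ac≡ : L + M ≡ d a c
        ac≡ = m+[n∸m]≡n L≤ac
        BE≤ : d B E ≤ K + K
        BE≤ = ≤-trans (d-triangle B a E) (subst (λ x → x + d a E ≤ K + K) (d-sym a B) (aB≤K ⊕ aE≤K))
        toward-a : ∀ {X} → d a X ≤ K → d X a ≤ K + L
        toward-a aX≤K = d-sym-≤ (≤-trans aX≤K (m≤m+n K L))
        shuffle : ∀ K L M → K + (L + M) ≡ (K + M) + L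
        shuffle = solve-∀
        toward-c : ∀ {X} → d c X + L ≤ K + d a c → d X c ≤ K + M
        toward-c cX+L≤ = d-sym-≤
          (+-cancelʳ-≤ L _ _ (≤-trans cX+L≤ (≤-reflexive (trans (cong (K +_) (sym ac≡)) (shuffle K L M)))))

    record BalancedWitness (t : ℕ) (b c e : V G) : Set where
      field
        apex : V G
        σ : ℕ
        σ≤1 : σ ≤ 1
        witness : HbWitness t apex b c e
        balanced : d apex b + d apex e ≡ d b e + σ

    toward-both : ∀ a b e h → h + h + d b e ≤ d a b + d a e →
                  ∃ λ A → d a A ≤ h × d A b + h ≤ d a b × d A e + h ≤ d a e
    toward-both a b e h 2h+be≤ with m≤n⇒∃[o]m+o≡n h≤ab | m≤n⇒∃[o]m+o≡n h≤ae
      where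
        half : ∀ p s y → h + h + y ≤ p + s → s ≤ p + y → h ≤ p
        half p s y 2h+y≤ s≤ = half-≤ (m≤n⇒m≤1+n (≤-by-certificate (2h+y≤ ⊕ s≤) (solve (h ∷ p ∷ s ∷ y ∷ []))))
        h≤ab : h ≤ d a b
        h≤ab = half (d a b) (d a e) (d b e) 2h+be≤ (d-triangle a b e)
        h≤ae : h ≤ d a e
        h≤ae = half (d a e) (d a b) (d b e) (subst (h + h + d b e ≤_) (+-comm (d a b) (d a e)) 2h+be≤)
                    (d-triangle′ a e b)
    ... | P , h+P≡ab | S , h+S≡ae =
      let A , aA≤h , bA≤P , eA≤S = helly₃ a b e h P S (≤-reflexive (sym h+P≡ab)) (≤-reflexive (sym h+S≡ae)) be≤P+S
      in A , aA≤h , ≤-trans (+-monoˡ-≤ h (d-sym-≤ bA≤P)) (≤-reflexive (trans (+-comm P h) h+P≡ab))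
           , ≤-trans (+-monoˡ-≤ h (d-sym-≤ eA≤S)) (≤-reflexive (trans (+-comm S h) h+S≡ae))
      where
        cancel : ∀ p s y → h + h + y ≤ p + s → h + P ≡ p → h + S ≡ s → y ≤ P + S
        cancel p s y 2h+y≤ h+P≡p h+S≡s = ≤-by-certificate (2h+y≤ ⊕ ≤-reflexive (sym h+P≡p) ⊕ ≤-reflexive (sym h+S≡s))
          (solve (h ∷ P ∷ S ∷ p ∷ s ∷ y ∷ []))
        be≤P+S : d b e ≤ P + S
        be≤P+S = cancel (d a b) (d a e) (d b e) 2h+be≤ h+P≡ab h+S≡ae

    balance : ∀ {t a b c e} → HbWitness t a b c e → BalancedWitness t b c e
    balance {t} {a} {b} {c} {e} w with halve (d a b + d a e ∸ d b e)
    ... | h , 2h≤ε , ε≤2h+1 = balanced-at (toward-both a b e h 2h+be≤)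
      where
        ε = d a b + d a e ∸ d b e
        be+ε≡ : d b e + ε ≡ d a b + d a e
        be+ε≡ = m+[n∸m]≡n (d-triangle″ b a e)
        2h+be≤ : h + h + d b e ≤ d a b + d a e
        2h+be≤ = ≤-trans (+-monoˡ-≤ (d b e) 2h≤ε) (≤-reflexive (trans (+-comm ε (d b e)) be+ε≡))
        defect : ∀ p s y ε p′ s′ → y + ε ≡ p + s → ε ≤ suc (h + h) → p′ + h ≤ p → s′ + h ≤ s → p′ + s′ ≤ y + 1
        defect p s y ε p′ s′ y+ε≡ ε≤ p′+h≤ s′+h≤ = ≤-by-certificate (≤-reflexive (sym y+ε≡) ⊕ ε≤ ⊕ p′+h≤ ⊕ s′+h≤)
          (solve (h ∷ p ∷ s ∷ y ∷ ε ∷ p′ ∷ s′ ∷ []))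
        balanced-at : (∃ λ A → d a A ≤ h × d A b + h ≤ d a b × d A e + h ≤ d a e) → BalancedWitness t b c e
        balanced-at (A , aA≤h , Ab+h≤ , Ae+h≤) = record
          { apex = A
          ; σ = d A b + d A e ∸ d b e
          ; σ≤1 = m≤n+o⇒m∸n≤o (d A b + d A e) (d b e)
                    (defect (d a b) (d a e) (d b e) ε (d A b) (d A e) be+ε≡ ε≤2h+1 Ab+h≤ Ae+h≤)
          ; witness = witness-shift {t} {a} {b} {c} {e} {A} {h} w aA≤h Ab+h≤ Ae+h≤
          ; balanced = sym (m+[n∸m]≡n (d-triangle″ b A e))
          }

    module _ {t b c e} (W : BalancedWitness t b c e) where
      open BalancedWitness W renaming (apex to a)

      excess : ℕ
      excess = suc t + σ

      private
        double-bound : ∀ δ σ p s r x y → δ + (s + r) ≤ x + y → x ≤ p + r → p + s ≡ y + σ → δ + σ ≤ p + p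
        double-bound δ σ p s r x y D tri bal = ≤-by-certificate (D ⊕ tri ⊕ ≤-reflexive (sym bal))
          (solve (δ ∷ σ ∷ p ∷ s ∷ r ∷ x ∷ y ∷ []))
        diagonal-bound : ∀ δ σ p s r r′ x y → δ + (p + r) ≤ x + y → δ + (s + r′) ≤ x + y → y ≤ r′ + r →
                         p + s ≡ y + σ → σ ≤ 1 → δ + σ ≤ x
        diagonal-bound δ σ p s r r′ x y D₁ D₂ tri bal σ≤1 = half-≤ (≤-by-certificate
          (D₁ ⊕ D₂ ⊕ tri ⊕ ≤-reflexive (sym bal) ⊕ σ≤1) (solve (δ ∷ σ ∷ p ∷ s ∷ r ∷ r′ ∷ x ∷ y ∷ [])))
        side-bound : ∀ δ σ p s r x y → δ + (s + r) ≤ x + y → p + s ≡ y + σ → r + (δ + σ) ≤ p + x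
        side-bound δ σ p s r x y D bal = ≤-by-certificate (D ⊕ ≤-reflexive (sym bal))
          (solve (δ ∷ σ ∷ p ∷ s ∷ r ∷ x ∷ y ∷ []))
        p = d a b
        s = d a e
        x = d a c
        y = d b e

      excess≤ab+ab : excess ≤ d a b + d a b
      excess≤ab+ab = double-bound (suc t) σ p s (d c b) x y (proj₂ witness) (d-triangle′ a b c) balanced

      excess≤ae+ae : excess ≤ d a e + d a e
      excess≤ae+ae = double-bound (suc t) σ s p (d c e) x y (proj₁ witness) (d-triangle′ a e c)
                                  (trans (+-comm s p) balanced)

      excess≤ac : excess ≤ d a c
      excess≤ac = diagonal-bound (suc t) σ p s (d c e) (d c b) x y (proj₁ witness) (proj₂ witness)
                                 (d-triangle″ b c e) balanced σ≤1

      bc+excess≤ : d b c + excess ≤ d a b + d a c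
      bc+excess≤ = subst (λ z → z + excess ≤ p + x) (d-sym c b)
        (side-bound (suc t) σ p s (d c b) x y (proj₂ witness) balanced)

      ec+excess≤ : d e c + excess ≤ d a e + d a c
      ec+excess≤ = subst (λ z → z + excess ≤ s + x) (d-sym c e)
        (side-bound (suc t) σ s p (d c e) x y (proj₁ witness) (trans (+-comm s p) balanced))

      record FarPair (K : ℕ) : Set where
        field
          B E : V G
          aB≡K : d a B ≡ K
          aE≡K : d a E ≡ K
          cB+excess≤ : d c B + excess ≤ K + d a c
          cE+excess≤ : d c E + excess ≤ K + d a c
          2K≤σ+BE : K + K ≤ σ + d B E

      far-points : ∀ K → excess ≤ K + K → K + K ≤ suc excess → FarPair K
      far-points K N≤2K 2K≤N+1 =
        let B , aB≡K , Bb+K≤p , cB+N≤ = point-toward a b c K excess (K≤ excess≤ab+ab) excess≤ac N≤2K bc+excess≤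
            E , aE≡K , Ee+K≤s , cE+N≤ = point-toward a e c K excess (K≤ excess≤ae+ae) excess≤ac N≤2K ec+excess≤
        in record { B = B ; E = E ; aB≡K = aB≡K ; aE≡K = aE≡K ; cB+excess≤ = cB+N≤ ; cE+excess≤ = cE+N≤
                  ; 2K≤σ+BE = long B E Bb+K≤p Ee+K≤s }
        where
          K≤ : ∀ {p} → excess ≤ p + p → K ≤ p
          K≤ N≤2p = half-≤ (≤-trans 2K≤N+1 (s≤s N≤2p))
          gap : ∀ σ p s y Bb BE Ee → Bb + K ≤ p → Ee + K ≤ s → p + s ≡ y + σ → y ≤ Bb + (BE + Ee) → K + K ≤ σ + BE
          gap σ p s y Bb BE Ee Bb+K≤ Ee+K≤ bal y≤ = ≤-by-certificate (Bb+K≤ ⊕ Ee+K≤ ⊕ ≤-reflexive bal ⊕ y≤)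
            (solve (K ∷ σ ∷ p ∷ s ∷ y ∷ Bb ∷ BE ∷ Ee ∷ []))
          long : ∀ B E → d B b + K ≤ p → d E e + K ≤ s → K + K ≤ σ + d B E
          long B E Bb+K≤ Ee+K≤ = gap σ p s y (d B b) (d B E) (d E e) Bb+K≤ Ee+K≤ balanced
            (≤-trans (d-triangle″ b B e) (+-monoʳ-≤ (d B b) (d-triangle B E e)))

    diamond-from-balanced : ∀ k {b c e} → BalancedWitness (2 * k) b c e → ∃ (DiamondSquare k)
    diamond-from-balanced k {b} {c} {e} W@record { apex = a ; σ = σ ; σ≤1 = σ≤1 } = by-length (suc k + suc k ≤? d B E)
      where
        N≤2K : suc (2 * k) + σ ≤ suc k + suc k
        N≤2K = ≤-by-certificate σ≤1 (solve (k ∷ σ ∷ []))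
        2K≤N+1 : suc k + suc k ≤ suc (suc (2 * k) + σ)
        2K≤N+1 = ≤-by-certificate (z≤n {σ}) (solve (k ∷ σ ∷ []))
        open FarPair (far-points W (suc k) N≤2K 2K≤N+1)
        2k+2≡2K : suc (suc (2 * k)) ≡ suc k + suc k
        2k+2≡2K = solve (k ∷ [])
        K<2K : suc k < suc k + suc k
        K<2K = ≤-by-certificate (z≤n {k}) (solve (k ∷ []))
        2k<2K : 2 * k < suc k + suc k
        2k<2K = ≤-by-certificate (z≤n {1}) (solve (k ∷ []))
        short-diagonal : ∀ BE → suc k + suc k ≤ σ + BE → BE < suc k + suc k → suc k + suc k ≤ suc (2 * k) + σ
        short-diagonal BE 2K≤σ+BE BE<2K = ≤-by-certificate (2K≤σ+BE ⊕ BE<2K) (solve (k ∷ σ ∷ BE ∷ []))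
        long-diagonal : ∀ BE → suc k + suc k ≤ σ + BE → 2 * k < BE
        long-diagonal BE 2K≤σ+BE = ≤-by-certificate (2K≤σ+BE ⊕ σ≤1) (solve (k ∷ σ ∷ BE ∷ []))
        opposite : ∀ L → L ≤ suc (2 * k) + σ → Opposite a B E (suc k) L
        opposite L L≤N = opposite-point a B E c (suc k) L (≤-reflexive aB≡K) (≤-reflexive aE≡K)
          (≤-trans L≤N (excess≤ac W)) (shrink cB+excess≤) (shrink cE+excess≤)
          where
            shrink : ∀ {X} → d c X + (suc (2 * k) + σ) ≤ suc k + d a c → d c X + L ≤ suc k + d a c
            shrink = ≤-trans (+-monoʳ-≤ _ L≤N)
        by-length : Dec (suc k + suc k ≤ d B E) → ∃ (DiamondSquare k)
        by-length (yes 2K≤BE) = quad a B C E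
          , square-from-sides (≤-reflexive aB≡K) BC≤K (d-sym-≤ EC≤K) (d-sym-≤ (≤-reflexive aE≡K)) (≤-trans K<2K 2K≤BE)
                              (≤-reflexive (sym aC≡L)) (≤-trans 2k<2K 2K≤BE)
          , ≤-reflexive aC≡L
          , ≤-trans (≤-reflexive 2k+2≡2K) 2K≤BE
          where open Opposite (opposite (suc (2 * k)) (m≤m+n _ σ))
        -- Here d(B,E) = 2K - 1 forces σ = 1, which leaves room to put C at distance 2K from a.
        by-length (no 2K≰BE) = quad B C E a
          , square-from-sides BC≤K (d-sym-≤ EC≤K) (d-sym-≤ (≤-reflexive aE≡K)) (≤-reflexive aB≡K)
                              (subst (suc k <_) (sym Ca≡2K) K<2K) 2k<BE (subst (2 * k <_) (sym Ca≡2K) 2k<2K)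
          , ≤-pred (≤-trans (≰⇒> 2K≰BE) (≤-reflexive (sym 2k+2≡2K)))
          , subst (suc (2 * k) <_) (sym Ca≡2K) (≤-reflexive 2k+2≡2K)
          where
            2K≤N : suc k + suc k ≤ suc (2 * k) + σ
            2K≤N = short-diagonal (d B E) 2K≤σ+BE (≰⇒> 2K≰BE)
            open Opposite (opposite (suc k + suc k) 2K≤N)
            Ca≡2K : d C a ≡ suc k + suc k
            Ca≡2K = trans (d-sym C a) aC≡L
            2k<BE : 2 * k < d B E
            2k<BE = long-diagonal (d B E) 2K≤σ+BE

    square-from-balanced : ∀ k {b c e} → BalancedWitness (suc (2 * k)) b c e →
      ∃ (Square (suc k) (suc (2 * k))) ⊎ ∃ (Square (suc (suc k)) (suc (suc (2 * k))))
    square-from-balanced k {b} {c} {e} W@record { apex = a ; σ = σ ; σ≤1 = σ≤1 } =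
      ≤1-cases (λ σ → ∃ (Square (σ + suc k) (σ + suc (2 * k)))) σ≤1
        (quad a B C E , square-from-sides (≤-reflexive aB≡K) BC≤K (d-sym-≤ EC≤K) (d-sym-≤ (≤-reflexive aE≡K))
                          (K<BE (d B E) 2K≤σ+BE) (≤-reflexive (trans g+1≡N (sym aC≡L))) (g<BE (d B E) 2K≤σ+BE))
      where
        -- K = ⌈(2k + 2 + σ)/2⌉, written so that σ = 0, 1 give the two squares of the statement definitionally.
        K = σ + suc k
        N≤2K : suc (suc (2 * k)) + σ ≤ σ + suc k + (σ + suc k)
        N≤2K = ≤-by-certificate (z≤n {σ}) (solve (k ∷ σ ∷ []))
        2K≤N+1 : σ + suc k + (σ + suc k) ≤ suc (suc (suc (2 * k)) + σ)
        2K≤N+1 = ≤-by-certificate σ≤1 (solve (k ∷ σ ∷ []))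
        open FarPair (far-points W K N≤2K 2K≤N+1)
        open Opposite (opposite-point a B E c K (suc (suc (2 * k)) + σ) (≤-reflexive aB≡K) (≤-reflexive aE≡K)
                                      (excess≤ac W) cB+excess≤ cE+excess≤)
        K<BE : ∀ BE → σ + suc k + (σ + suc k) ≤ σ + BE → σ + suc k < BE
        K<BE BE 2K≤σ+BE = ≤-by-certificate (2K≤σ+BE ⊕ z≤n {k}) (solve (k ∷ σ ∷ BE ∷ []))
        g<BE : ∀ BE → σ + suc k + (σ + suc k) ≤ σ + BE → σ + suc (2 * k) < BE
        g<BE BE 2K≤σ+BE = ≤-by-certificate 2K≤σ+BE (solve (k ∷ σ ∷ BE ∷ []))
        g+1≡N : suc (σ + suc (2 * k)) ≡ suc (suc (2 * k)) + σ
        g+1≡N = solve (k ∷ σ ∷ [])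

    hb-from-no-diamond : ∀ k →
      ¬ (∃ λ q → BandC4 (suc k) (2 * k) q × Induces (PowAdj G (suc (2 * k))) Diamond q) → HbLeHalf G (2 * k)
    hb-from-no-diamond k none = hb-from-no-witness λ a b c e w →
      let q , sq , chord , far = diamond-from-balanced k (balance w)
      in none (q , square⇒band sq , square⇒Diamond sq (s≤s (m≤m+n k (k + 0))) chord far)

    hb-from-no-square : ∀ k → ¬ ∃ (BandC4 (suc k) (suc (2 * k))) → ¬ ∃ (BandC4 (suc (suc k)) (suc (suc (2 * k)))) →
                        HbLeHalf G (suc (2 * k))
    hb-from-no-square k none₁ none₂ = hb-from-no-witness λ a b c e w →
      refute (square-from-balanced k (balance w))
      where
        refute : ∃ (Square (suc k) (suc (2 * k))) ⊎ ∃ (Square (suc (suc k)) (suc (suc (2 * k)))) → ⊥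
        refute (inj₁ (q , sq)) = none₁ (q , square⇒band sq)
        refute (inj₂ (q , sq)) = none₂ (q , square⇒band sq)

theorem4 : (G : Graph) → Connected G → Helly G → (k : ℕ) →
    (HbLeHalf G (2 * k) ⇔
      (¬ ∃ λ (q : Fin 4 → V G) →
        (∀ ℓ → suc k ≤ ℓ → ℓ ≤ 2 * k → Induces (PowAdj G ℓ) C4 q) ×
        Induces (PowAdj G (suc (2 * k))) Diamond q))
    ×
    (HbLeHalf G (suc (2 * k)) ⇔
      ((¬ ∃ λ (q : Fin 4 → V G) →
          ∀ ℓ → suc k ≤ ℓ → ℓ ≤ suc (2 * k) → Induces (PowAdj G ℓ) C4 q) ×
       (¬ ∃ λ (q : Fin 4 → V G) →
          ∀ ℓ → suc (suc k) ≤ ℓ → ℓ ≤ suc (suc (2 * k)) → Induces (PowAdj G ℓ) C4 q)))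
theorem4 G connected helly k =
  mk⇔ (λ hb (q , band , diamond) → diamond-band-refutes-hb k band diamond hb)
      (hb-from-no-diamond helly k) ,
  mk⇔ (λ hb → (λ (q , band) → narrow-band-refutes-hb k band hb) , (λ (q , band) → wide-band-refutes-hb k band hb))
      (λ (none₁ , none₂) → hb-from-no-square helly k none₁ none₂)
  where open Distance G connected
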